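{- Let $G$ be a finite simple graph of order $p$ without isolated vertices, with independence number $\alpha$. Then $str(G)\ge 2p-2\alpha+1$.
   Context: For a graph $G$ of order $p$ with at least one edge, a numbering is a bijection $f:V(G)\to\{1,\dots,p\}$; $str_f(G)=\max\{f(u)+f(v): uv\in E(G)\}$ and $str(G)=\min\{str_f(G): f \text{ a numbering of } G\}$. -}

module Defs where

open import Data.Nat using (ℕ; zero; suc; _+_; _⊔_; _≤_)
open import Data.Bool using (Bool; true; false; if_then_else_)
open import Data.Fin using (Fin; toℕ)
open import Data.Fin.Subset using (Subset; _∈_; ∣_∣)
open import Data.List using (List; foldr; map; concatMap; allFin)
open import Data.Product using (Σ; ∃; ∃-syntax; _×_)
open import Relation.Binary.PropositionalEquality using (_≡_)
open import Relation.Nullary using (¬_)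
open import Function.Definitions using (Bijective)

record Graph (p : ℕ) : Set where
  field
    adj   : Fin p → Fin p → Bool
    sym   : ∀ u v → adj u v ≡ adj v u
    irrefl : ∀ v → adj v v ≡ false
open Graph public

Edge : ∀ {p} → Graph p → Fin p → Fin p → Set
Edge G u v = adj G u v ≡ true

HasEdge : ∀ {p} → Graph p → Set
HasEdge G = ∃[ u ] ∃[ v ] Edge G u v

NoIsolatedVertices : ∀ {p} → Graph p → Set
NoIsolatedVertices G = ∀ v → ∃[ u ] Edge G v u

Independent : ∀ {p} → Graph p → Subset p → Set
Independent G S = ∀ u v → u ∈ S → v ∈ S → ¬ Edge G u v

IsIndependenceNumber : ∀ {p} → Graph p → ℕ → Set
IsIndependenceNumber G α =
  (∃[ S ] (Independent G S × ∣ S ∣ ≡ α)) ×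
  (∀ S → Independent G S → ∣ S ∣ ≤ α)

-- A numbering is a bijection V(G) → {1,…,p}; we represent it as a bijection
-- f : Fin p → Fin p, the label of v being  toℕ (f v) + 1.
IsNumbering : ∀ {p} → (Fin p → Fin p) → Set
IsNumbering f = Bijective _≡_ _≡_ f

label : ∀ {p} → (Fin p → Fin p) → Fin p → ℕ
label f v = suc (toℕ (f v))

maxList : List ℕ → ℕ
maxList = foldr _⊔_ 0

-- str_f(G) = max { f(u) + f(v) : uv ∈ E(G) }  (computed over all ordered
-- pairs; non-edges contribute 0, which is harmless since labels are ≥ 1 and
-- G is assumed to have an edge).
strf : ∀ {p} → Graph p → (Fin p → Fin p) → ℕ
strf {p} G f =
  maxList (concatMap (λ u → map (λ v →
    if adj G u v then label f u + label f v else 0) (allFin p)) (allFin p))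

IsStrength : ∀ {p} → Graph p → ℕ → Set
IsStrength G s =
  (∃[ f ] (IsNumbering f × strf G f ≡ s)) ×
  (∀ f → IsNumbering f → s ≤ strf G f)

{-# OPTIONS --safe #-}
module Submission where

open import Defs hiding (sym)
open import Data.Nat using (ℕ; suc; _+_; _*_; _∸_; _≤_; _<_; z≤n; s≤s; _≤?_)
open import Data.Nat.Properties
open import Data.Fin using (Fin; toℕ; opposite; inject≤) renaming (zero to fz; suc to fs)
open import Data.Fin.Properties
  using (injective⇒≤; toℕ<n; toℕ-injective; opposite-prop; opposite-involutive; inject≤-injective; toℕ-inject≤)
import Data.Fin.Properties as Fin
open import Data.Fin.Subset using (Subset; _∈_; ∣_∣; inside; outside)
open import Data.Bool using (if_then_else_)
open import Data.Vec using (_∷_; tabulate; here; there)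
open import Data.Vec.Properties using (lookup⇒[]=; []=⇒lookup; lookup∘tabulate)
open import Data.List using (List; _∷_; map; concatMap; allFin)
open import Data.List.Membership.Propositional using () renaming (_∈_ to _∈ₗ_)
open import Data.List.Membership.Propositional.Properties using (∈-map⁺; ∈-concatMap⁺; ∈-allFin)
import Data.List.Relation.Unary.Any as Any
open import Data.Product using (_,_; proj₁; proj₂)
open import Function using (_∘_)
open import Function.Definitions using (Injective; Surjective)
open import Relation.Binary.PropositionalEquality
open import Relation.Nullary using (does; yes; no)
open import Relation.Nullary.Decidable using (dec-true)
open import Relation.Unary using (Pred; Decidable)

-- Fix a numbering f realising the strength s.  Call a vertex heavy when twice its
-- label is at least s.  Two heavy vertices cannot be adjacent: their label sum
-- would be at most s, forcing equal labels.  So at most α vertices are heavy.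
-- If s ≤ 2(p − α), the α + 1 vertices labelled p − α, …, p are all heavy,
-- which is impossible; hence s ≥ 2p − 2α + 1.

rank : ∀ {n} (S : Subset n) (v : Fin n) → v ∈ S → Fin ∣ S ∣
rank (inside  ∷ S) fz     here      = fz
rank (inside  ∷ S) (fs v) (there m) = fs (rank S v m)
rank (outside ∷ S) (fs v) (there m) = rank S v m

rank-injective : ∀ {n} (S : Subset n) {u v : Fin n} (u∈S : u ∈ S) (v∈S : v ∈ S) →
  rank S u u∈S ≡ rank S v v∈S → u ≡ v
rank-injective (inside  ∷ S) here        here        _  = refl
rank-injective (inside  ∷ S) (there u∈S) (there v∈S) eq =
  cong fs (rank-injective S u∈S v∈S (Fin.suc-injective eq))
rank-injective (outside ∷ S) (there u∈S) (there v∈S) eq =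
  cong fs (rank-injective S u∈S v∈S eq)

injective-into⇒≤∣∣ : ∀ {k n} (S : Subset n) {g : Fin k → Fin n} →
  Injective _≡_ _≡_ g → (∀ i → g i ∈ S) → k ≤ ∣ S ∣
injective-into⇒≤∣∣ S g-inj g∈S =
  injective⇒≤ (g-inj ∘ rank-injective S (g∈S _) (g∈S _))

subsetOf : ∀ {n ℓ} {P : Pred (Fin n) ℓ} → Decidable P → Subset n
subsetOf P? = tabulate (does ∘ P?)

∈-subsetOf⁺ : ∀ {n ℓ} {P : Pred (Fin n) ℓ} (P? : Decidable P) {v} → P v → v ∈ subsetOf P?
∈-subsetOf⁺ P? {v} Pv =
  lookup⇒[]= v (subsetOf P?) (trans (lookup∘tabulate (does ∘ P?) v) (dec-true (P? v) Pv))

∈-subsetOf⁻ : ∀ {n ℓ} {P : Pred (Fin n) ℓ} (P? : Decidable P) {v} → v ∈ subsetOf P? → P v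
∈-subsetOf⁻ P? {v} v∈ with P? v | trans (sym (lookup∘tabulate (does ∘ P?) v)) ([]=⇒lookup v∈)
... | yes Pv | _ = Pv
... | no _   | ()

∈⇒≤maxList : ∀ {x} (xs : List ℕ) → x ∈ₗ xs → x ≤ maxList xs
∈⇒≤maxList (y ∷ ys) (Any.here refl) = m≤m⊔n y (maxList ys)
∈⇒≤maxList (y ∷ ys) (Any.there x∈) = ≤-trans (∈⇒≤maxList ys x∈) (m≤n⊔m y (maxList ys))

∈-table : ∀ {n} {A : Set} (F : Fin n → Fin n → A) (u v : Fin n) →
  F u v ∈ₗ concatMap (λ u → map (F u) (allFin n)) (allFin n)
∈-table {n} F u v = ∈-concatMap⁺ (λ u → map (F u) (allFin n))
  (Any.map (λ { refl → ∈-map⁺ (F u) (∈-allFin v) }) (∈-allFin u))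

edge⇒label+label≤strf : ∀ {p} (G : Graph p) (f : Fin p → Fin p) {u v : Fin p} →
  Edge G u v → label f u + label f v ≤ strf G f
edge⇒label+label≤strf {p} G f {u} {v} uv =
  ∈⇒≤maxList _ (subst (_∈ₗ concatMap row (allFin p)) weight-uv (∈-table weight u v))
  where
  weight : Fin p → Fin p → ℕ
  weight u v = if adj G u v then label f u + label f v else 0
  weight-uv : weight u v ≡ label f u + label f v
  weight-uv rewrite uv = refl
  row : Fin p → List ℕ
  row u = map (weight u) (allFin p)

edge⇒≢ : ∀ {p} (G : Graph p) {u v : Fin p} → Edge G u v → u ≢ v
edge⇒≢ G {u} uv refl with trans (sym uv) (irrefl G u)
... | ()

m+n≤2*n⇒m≤n : ∀ {m n} → m + n ≤ 2 * n → m ≤ n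
m+n≤2*n⇒m≤n {m} {n} m+n≤2n = +-cancelʳ-≤ n m n (subst (m + n ≤_) (cong (n +_) (+-identityʳ n)) m+n≤2n)

opposite-injective : ∀ {n} → Injective _≡_ _≡_ (opposite {n})
opposite-injective {_} {i} {j} eq =
  trans (sym (opposite-involutive i)) (trans (cong opposite eq) (opposite-involutive j))

heavy? : ∀ {p} (f : Fin p → Fin p) (s : ℕ) → Decidable (λ v → s ≤ 2 * label f v)
heavy? f s v = s ≤? 2 * label f v

heavy : ∀ {p} → (Fin p → Fin p) → ℕ → Subset p
heavy f s = subsetOf (heavy? f s)

heavy-independent : ∀ {p} (G : Graph p) {f : Fin p → Fin p} {s : ℕ} → Injective _≡_ _≡_ f →
  (∀ {u v} → Edge G u v → label f u + label f v ≤ s) → Independent G (heavy f s)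
heavy-independent G {f} {s} f-inj bounded u v u∈ v∈ uv =
  edge⇒≢ G uv (f-inj (toℕ-injective (suc-injective (≤-antisym lu≤lv lv≤lu))))
  where
  lu≤lv : label f u ≤ label f v
  lu≤lv = m+n≤2*n⇒m≤n (≤-trans (bounded uv) (∈-subsetOf⁻ (heavy? f s) v∈))
  lv≤lu : label f v ≤ label f u
  lv≤lu = m+n≤2*n⇒m≤n (≤-trans (subst (_≤ s) (+-comm (label f u) (label f v)) (bounded uv)) (∈-subsetOf⁻ (heavy? f s) u∈))

≤∣heavy∣ : ∀ {p k s} {f : Fin p → Fin p} → Surjective _≡_ _≡_ f → k ≤ p →
  s ≤ 2 * suc (p ∸ k) → k ≤ ∣ heavy f s ∣
≤∣heavy∣ {p} {k} {s} {f} f-surj k≤p s≤ =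
  injective-into⇒≤∣∣ (heavy f s) g-injective
    (λ i → ∈-subsetOf⁺ (heavy? f s) (≤-trans s≤ (*-monoʳ-≤ 2 (label-g i))))
  where
  f⁻¹ : Fin p → Fin p
  f⁻¹ y = proj₁ (f-surj y)
  f∘f⁻¹ : ∀ y → f (f⁻¹ y) ≡ y
  f∘f⁻¹ y = proj₂ (f-surj y) refl
  f⁻¹-injective : Injective _≡_ _≡_ f⁻¹
  f⁻¹-injective {x} {y} eq = trans (sym (f∘f⁻¹ x)) (trans (cong f eq) (f∘f⁻¹ y))
  -- g i is the vertex labelled p − i
  g : Fin k → Fin p
  g i = f⁻¹ (opposite (inject≤ i k≤p))
  g-injective : Injective _≡_ _≡_ g
  g-injective = inject≤-injective k≤p k≤p _ _ ∘ opposite-injective ∘ f⁻¹-injective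
  label-g : ∀ i → suc (p ∸ k) ≤ label f (g i)
  label-g i = begin
    suc (p ∸ k)                           ≤⟨ s≤s (∸-monoʳ-≤ p (toℕ<n i)) ⟩
    suc (p ∸ suc (toℕ i))                 ≡⟨ cong (λ t → suc (p ∸ suc t)) (sym (toℕ-inject≤ i k≤p)) ⟩
    suc (p ∸ suc (toℕ (inject≤ i k≤p)))   ≡⟨ cong suc (sym (opposite-prop (inject≤ i k≤p))) ⟩
    suc (toℕ (opposite (inject≤ i k≤p))) ≡⟨ cong (suc ∘ toℕ) (sym (f∘f⁻¹ _)) ⟩
    label f (g i)                         ∎
    where open ≤-Reasoning

doubled-gap<strf : ∀ {p} (G : Graph p) {α : ℕ} {f : Fin p → Fin p} → HasEdge G →
  (∀ S → Independent G S → ∣ S ∣ ≤ α) → IsNumbering f → 2 * (p ∸ α) < strf G f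
doubled-gap<strf {p} G {α} {f} (u , v , uv) α-max (f-inj , f-surj) with p ≤? α
... | yes p≤α = begin-strict
  2 * (p ∸ α)           ≡⟨ cong (2 *_) (m≤n⇒m∸n≡0 p≤α) ⟩
  0                     <⟨ s≤s z≤n ⟩
  label f u + label f v ≤⟨ edge⇒label+label≤strf G f uv ⟩
  strf G f              ∎
  where open ≤-Reasoning
... | no p≰α = ≰⇒> λ strf≤ → 1+n≰n (≤-trans
  (≤∣heavy∣ f-surj α<p (subst (strf G f ≤_) (cong (2 *_) (+-∸-assoc 1 α<p)) strf≤))
  (α-max _ (heavy-independent G f-inj (edge⇒label+label≤strf G f))))
  where
  α<p : α < p
  α<p = ≰⇒> p≰α

mainTheorem3 : (p : ℕ) (G : Graph p) (α : ℕ) (s : ℕ) →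
    HasEdge G → NoIsolatedVertices G → IsIndependenceNumber G α →
    IsStrength G s → 2 * p ∸ 2 * α + 1 ≤ s
mainTheorem3 p G α _ has-edge _ (_ , α-max) ((f , f-numbering , refl) , _) = begin
  2 * p ∸ 2 * α + 1   ≡⟨ +-comm _ 1 ⟩
  suc (2 * p ∸ 2 * α) ≡⟨ cong suc (sym (*-distribˡ-∸ 2 p α)) ⟩
  suc (2 * (p ∸ α))   ≤⟨ doubled-gap<strf G has-edge α-max f-numbering ⟩
  strf G f            ∎
  where open ≤-Reasoning
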